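{- Let $n,k,d$ be positive integers with $2 \le d \le k$ and $n \ge 2k-d+2$, and suppose $\mathcal{F} \subseteq \binom{[n]}{k}$ contains no simple $d$-cluster. If $B, B' \in \mathcal{F}$ satisfy $|\alpha_{\mathcal{F}}(B) \cap B'| \ge d-2$, then $|B \cap B'| \ge d-1$.
   Context: $[n] = \{1,\dots,n\}$ and $\binom{X}{k}$ denotes the set of $k$-element subsets of $X$. A simple $d$-cluster is a collection $\{B, B', B_1,\dots,B_{d-2}\}$ of elements of $\binom{[n]}{k}$ such that $B \cap B' = \{a_1,\dots,a_{d-2}\}$ (with the $a_i$ distinct) and $B \setminus B_i = \{a_i\}$ for every $i \in [d-2]$ (for $d=2$: $B \cap B' = \emptyset$). For $B \in \mathcal{F}$, $\alpha_{\mathcal{F}}(B) = \{y \in B : \text{there exists } B'' \in \mathcal{F} \text{ with } B \setminus B'' = \{y\}\}$. -}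

module Defs where

open import Data.Nat using (ℕ; _∸_)
open import Data.Fin using (Fin)
open import Data.Fin.Subset using (Subset; _∈_; _∉_; _∩_; ∣_∣)
open import Data.Product using (Σ; ∃; _×_)
open import Function.Definitions using (Injective)
open import Function.Bundles using (_⇔_)
open import Relation.Binary.PropositionalEquality using (_≡_)

Family : ℕ → Set₁
Family n = Subset n → Set

Uniform : ∀ {n} → ℕ → Family n → Set
Uniform k F = ∀ B → F B → ∣ B ∣ ≡ k

DiffSingleton : ∀ {n} → Subset n → Subset n → Fin n → Set
DiffSingleton B C y = ∀ x → ((x ∈ B × x ∉ C) ⇔ (x ≡ y))

SimpleCluster : ∀ {n} → ℕ → Family n → Set
SimpleCluster {n} d F =
  Σ (Subset n) λ B → Σ (Subset n) λ B' →
  Σ (Fin (d ∸ 2) → Fin n) λ a → Σ (Fin (d ∸ 2) → Subset n) λ Bs →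
    F B × F B' × (∀ i → F (Bs i)) × Injective _≡_ _≡_ a ×
    (∀ x → (x ∈ (B ∩ B')) ⇔ (∃ λ i → a i ≡ x)) ×
    (∀ i → DiffSingleton B (Bs i) (a i))

InAlpha : ∀ {n} → Family n → Subset n → Fin n → Set
InAlpha F B y = y ∈ B × ∃ λ B'' → F B'' × DiffSingleton B B'' y

AtLeast : ∀ {n} → ℕ → (Fin n → Set) → Set
AtLeast {n} m P = Σ (Fin m → Fin n) λ f → Injective _≡_ _≡_ f × (∀ i → P (f i))

module Submission where

open import Defs
open import Data.Nat using (ℕ; _≤_; _+_; _∸_; _*_; zero; suc; z≤n; s≤s)
open import Data.Nat.Properties using (≤-<-trans; ≤-trans; ≮⇒≥; m<1+n⇒m≤n; n≮n)
open import Data.Fin using (Fin; zero; suc)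
open import Data.Fin.Properties using (any?; 0≢1+n; suc-injective) renaming (_≟_ to _≟ᶠ_)
open import Data.Fin.Subset using (Subset; _∈_; _∩_; _-_; ∣_∣)
open import Data.Fin.Subset.Properties using (x∈p∩q⁺; x∈p∧x≢y⇒x∈p-y; x∈p⇒∣p-x∣<∣p∣)
open import Data.Product using (_×_; ∃; _,_; proj₁; proj₂)
open import Data.Empty using (⊥-elim)
open import Data.Vec.Functional using (_∷_)
open import Function using (_∘_)
open import Function.Bundles using (_⇔_; mk⇔)
open import Relation.Nullary using (¬_; yes; no)
open import Relation.Binary.PropositionalEquality using (_≡_; refl; sym; cong)

-- The d − 2 witnesses of |α(B) ∩ B'| ≥ d − 2 lie in B ∩ B'. If |B ∩ B'| ≤ d − 2 they
-- exhaust B ∩ B', and together with the sets B'' certifying their membership in α(B)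
-- they form a simple d-cluster with B and B'.

AtLeast-∈⇒≤∣∣ : ∀ {n} m (S : Subset n) → AtLeast m (_∈ S) → m ≤ ∣ S ∣
AtLeast-∈⇒≤∣∣ zero    S _             = z≤n
AtLeast-∈⇒≤∣∣ (suc m) S (f , inj , f∈S) =
  ≤-<-trans (AtLeast-∈⇒≤∣∣ m (S - f zero) (f ∘ suc , suc-injective ∘ inj , f∘suc∈S-f₀))
            (x∈p⇒∣p-x∣<∣p∣ (f∈S zero))
  where
  f∘suc∈S-f₀ : ∀ i → f (suc i) ∈ S - f zero
  f∘suc∈S-f₀ i = x∈p∧x≢y⇒x∈p-y (f∈S (suc i)) (λ eq → 0≢1+n (sym (inj eq)))

AtLeast-∈-∣∣⇒surjective : ∀ {n m} (S : Subset n) → ∣ S ∣ ≤ m →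
  ((f , _ , _) : AtLeast m (_∈ S)) → ∀ x → x ∈ S → ∃ λ i → f i ≡ x
AtLeast-∈-∣∣⇒surjective {m = m} S ∣S∣≤m (f , inj , f∈S) x x∈S
  with any? (λ i → f i ≟ᶠ x)
... | yes hit = hit
... | no miss =
  ⊥-elim (n≮n m (≤-trans (AtLeast-∈⇒≤∣∣ (suc m) S (x ∷ f , x∷f-injective , x∷f∈S)) ∣S∣≤m))
  where
  x∷f-injective : ∀ {i j} → (x ∷ f) i ≡ (x ∷ f) j → i ≡ j
  x∷f-injective {zero}  {zero}  _  = refl
  x∷f-injective {zero}  {suc j} eq = ⊥-elim (miss (j , sym eq))
  x∷f-injective {suc i} {zero}  eq = ⊥-elim (miss (i , eq))
  x∷f-injective {suc i} {suc j} eq = cong suc (inj eq)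
  x∷f∈S : ∀ i → (x ∷ f) i ∈ S
  x∷f∈S zero    = x∈S
  x∷f∈S (suc i) = f∈S i

proposition3 : (n k d : ℕ) → 2 ≤ d → d ≤ k → 2 * k ∸ d + 2 ≤ n →
    (F : Family n) → Uniform k F → ¬ SimpleCluster d F →
    (B B' : Subset n) → F B → F B' →
    AtLeast (d ∸ 2) (λ y → InAlpha F B y × y ∈ B') →
    d ∸ 1 ≤ ∣ B ∩ B' ∣
proposition3 n k (suc (suc e)) (s≤s (s≤s z≤n)) _ _ F _ noCluster B B' FB FB' (a , a-inj , a∈αB∩B') =
  ≮⇒≥ (λ small → noCluster
    (B , B' , a , B'' , FB , FB' , F-B'' , a-inj , B∩B'≡im-a (m<1+n⇒m≤n small) , B-B''≡a))
  where
  B'' : Fin e → Subset n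
  B'' i = proj₁ (proj₂ (proj₁ (a∈αB∩B' i)))
  F-B'' : ∀ i → F (B'' i)
  F-B'' i = proj₁ (proj₂ (proj₂ (proj₁ (a∈αB∩B' i))))
  B-B''≡a : ∀ i → DiffSingleton B (B'' i) (a i)
  B-B''≡a i = proj₂ (proj₂ (proj₂ (proj₁ (a∈αB∩B' i))))
  a∈B∩B' : ∀ i → a i ∈ B ∩ B'
  a∈B∩B' i = x∈p∩q⁺ (proj₁ (proj₁ (a∈αB∩B' i)) , proj₂ (a∈αB∩B' i))
  B∩B'≡im-a : ∣ B ∩ B' ∣ ≤ e → ∀ x → (x ∈ B ∩ B') ⇔ (∃ λ i → a i ≡ x)
  B∩B'≡im-a ∣B∩B'∣≤e x =
    mk⇔ (AtLeast-∈-∣∣⇒surjective (B ∩ B') ∣B∩B'∣≤e (a , a-inj , a∈B∩B') x)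
        (λ { (i , refl) → a∈B∩B' i })
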